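{- Let $T_{4,1}$ be the straight tetriamond: four cells of the triangular tiling forming a chain of alternately upward and downward pointing triangles in a single row, whose union is a parallelogram with side lengths $1$ and $2$. Then $\tau(T_{4,1})=(0,3,8,\infty)$, i.e. $T_{4,1}$ is a $(1,1)$-loser, a $(2,3)$-winner, a $(2,4)$-loser, a $(3,8)$-winner, a $(3,9)$-loser, and an $(n,b)$-winner for all $n\ge4$ and all $b\ge0$ (and trivially a $(1,0)$-winner).
   Context: The board is the tiling of the plane by unit equilateral triangles (cells); cells are adjacent if they share an edge. A polyiamond is a finite connected set of cells up to congruence. In the weak $(a,b)$ achievement game ($a\ge1,b\ge0$) for a goal polyiamond $A$ on the infinite board, maker and breaker alternately mark previously unmarked cells, maker first, $a$ resp. $b$ cells per turn; the maker wins if his marked cells at some point contain a set congruent to $A$; $A$ is an $(a,b)$-winner if the maker has a strategy guaranteeing a win in finitely many turns against every breaker play, otherwise an $(a,b)$-loser. The threshold sequence $\tau(A)=(b_1,b_2,\ldots)$ has $b_n$ the greatest $b$ for which $A$ is an $(n,b)$-winner ($\infty$ if for all $b$); $(b_1,\ldots,b_{k-1},\infty)$ denotes the sequence with $b_n=\infty$ for all $n\ge k$. -}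

module Defs where

open import Data.Bool using (Bool; true; false)
open import Data.Nat using (ℕ; _≥_)
open import Data.Integer using (ℤ; +_; _+_; _-_; -_)
open import Data.Product using (_×_; _,_; Σ; ∃; ∃-syntax)
open import Data.Sum using (_⊎_)
open import Data.List using (List; []; _∷_; _++_; length)
open import Data.List.Relation.Unary.All using (All)
open import Data.List.Relation.Unary.Any using (Any)
open import Data.List.Membership.Propositional using (_∉_)
open import Data.List.Relation.Unary.Unique.Propositional using (Unique)
open import Relation.Binary.PropositionalEquality using (_≡_)
open import Relation.Nullary using (¬_)

-- A cell is (x , y , up?).  We embed cells into "triangle coordinates"
-- (a , b , c) ∈ ℤ³: an upward cell (x,y,true) is (x , y , 1 - x - y)
-- (coordinate sum 1), a downward cell (x,y,false) is (x , y , 2 - x - y)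
-- (coordinate sum 2).  Every triple with sum 1 or 2 is a cell, and two
-- cells share an edge iff their triples differ by 1 in exactly one
-- coordinate.

Cell : Set
Cell = ℤ × ℤ × Bool

Triple : Set
Triple = ℤ × ℤ × ℤ

toTriple : Cell → Triple
toTriple (x , y , true)  = (x , y , + 1 - x - y)
toTriple (x , y , false) = (x , y , + 2 - x - y)

-- Symmetries of the tiling (= isometries of the plane mapping cells to
-- cells): a permutation of the three coordinates, optionally followed by
-- the point inversion t ↦ (1,1,1) - t, followed by a translation by
-- (p , q , -p-q).  These form the full symmetry group of the tiling
-- (point group of order 12 times the translation lattice).

data Perm3 : Set where
  abc acb bac bca cab cba : Perm3

permute : Perm3 → Triple → Triple
permute abc (a , b , c) = (a , b , c)
permute acb (a , b , c) = (a , c , b)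
permute bac (a , b , c) = (b , a , c)
permute bca (a , b , c) = (b , c , a)
permute cab (a , b , c) = (c , a , b)
permute cba (a , b , c) = (c , b , a)

invert : Bool → Triple → Triple
invert false t = t
invert true (a , b , c) = (+ 1 - a , + 1 - b , + 1 - c)

translate : ℤ → ℤ → Triple → Triple
translate p q (a , b , c) = (a + p , b + q , c - p - q)

record Symmetry : Set where
  constructor sym
  field
    perm : Perm3
    inv  : Bool
    dx   : ℤ
    dy   : ℤ

applySym : Symmetry → Triple → Triple
applySym (sym σ ε p q) t = translate p q (invert ε (permute σ t))

ContainsCopy : List Cell → List Cell → Set
ContainsCopy A S =
  ∃[ g ] All (λ c → Any (λ s → toTriple s ≡ applySym g (toTriple c)) S) A

LegalMove : ℕ → List Cell → List Cell → Set
LegalMove n marked xs = length xs ≡ n × Unique xs × All (λ x → x ∉ marked) xs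

-- MakerWins A a b M B : in the position where maker has marked M and
-- breaker has marked B, with maker to move, maker has a strategy that wins
-- in finitely many turns against every breaker play.  (Inductive, hence
-- every play following the strategy ends after finitely many turns.)
data MakerWins (A : List Cell) (a b : ℕ) : List Cell → List Cell → Set where
  move : ∀ {M B} (xs : List Cell) →
         LegalMove a (M ++ B) xs →
         ContainsCopy A (xs ++ M) ⊎
           (∀ ys → LegalMove b ((xs ++ M) ++ B) ys →
                   MakerWins A a b (xs ++ M) (ys ++ B)) →
         MakerWins A a b M B

Winner : List Cell → ℕ → ℕ → Set
Winner A a b = MakerWins A a b [] []

Loser : List Cell → ℕ → ℕ → Set
Loser A a b = ¬ Winner A a b

T41 : List Cell
T41 = (+ 0 , + 0 , true) ∷ (+ 0 , + 1 , false) ∷ (+ 0 , + 1 , true)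
      ∷ (+ 0 , + 2 , false) ∷ []

-- Maker's wins are explicit.  (1,0): claim the four cells one per turn.
-- (n,b) with n ≥ 4: claim a whole copy at once.  (2,3) and (3,8): after a
-- suitable first move there are 4 resp. 9 pairwise disjoint second moves
-- each completing a copy, more than breaker can block (`two-move-win`; the
-- configurations are verified by computation).
--
-- Breaker's wins rest on a pairing of the board into diamonds (two adjacent
-- cells), defined from the colouring (x - y) mod 3 of positions.  A finite
-- check over the 12 linear parts of the symmetries and the 3 translation
-- classes of the colouring shows that every copy of T41 is a chain: four
-- distinct cells, consecutive ones adjacent, exactly one of the three edges
-- joining partners (`chainOfCopy`).  A general invariant principle
-- (`BreakerStrategy`) then gives the three losers: at (1,1) breaker takes
-- the partner of maker's cell, at (2,4) the non-partner neighbours of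
-- maker's cells and the partners of maker's cells adjacent to another one,
-- at (3,9) all neighbours of maker's cells; in each case maker's cells never
-- contain a chain.

module Submission where

open import Defs renaming (sym to symmetry)
open import Function using (_∘_)
open import Data.Bool using (Bool; true; false; not)
import Data.Bool.Properties as Bool
open import Data.Nat using (ℕ; zero; suc; _≤_; _<_; _≥_; _∸_; z≤n; s≤s) renaming (_+_ to _+ℕ_)
import Data.Nat.Properties as ℕ
open import Data.Integer using (ℤ; +_; -[1+_]; _+_; _-_; -1ℤ; ∣_∣) renaming (suc to sucℤ; pred to predℤ)
import Data.Integer.Properties as ℤ
open import Algebra.Properties.AbelianGroup ℤ.+-0-abelianGroup using () renaming (∙-cancelʳ to +-cancelʳ)
open import Data.Integer.Tactic.RingSolver using (solve-∀)
open import Data.Product using (_×_; _,_; proj₁; proj₂; Σ)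
open import Data.Product.Properties using (≡-dec)
open import Data.Sum using (_⊎_; inj₁; inj₂; [_,_])
open import Data.Empty using (⊥; ⊥-elim)
open import Data.Unit using (tt)
open import Data.List using (List; []; _∷_; _++_; length; map; filter; deduplicate; concatMap)
import Data.List.Properties as List
open import Data.List.Membership.Propositional using (_∈_; _∉_; find)
open import Data.List.Membership.Propositional.Properties
  using (∈-++⁻; ∈-++⁺ˡ; ∈-++⁺ʳ; ∈-∃++; ∈-filter⁺; ∈-deduplicate⁺)
import Data.List.Membership.DecPropositional as DecMembership
open import Data.List.Relation.Binary.Subset.Propositional using (_⊆_)
open import Data.List.Relation.Binary.Permutation.Propositional using (↭-sym)
open import Data.List.Relation.Binary.Permutation.Propositional.Properties
  using (∈-resp-↭) renaming (shift to ↭-shift)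
open import Data.List.Relation.Unary.Any as Any using (Any; here; there; any?)
import Data.List.Relation.Unary.Any.Properties as Any
open import Data.List.Relation.Unary.All as All using (All; []; _∷_; all?)
import Data.List.Relation.Unary.All.Properties as All
open import Data.List.Relation.Unary.AllPairs using (AllPairs; []; _∷_; allPairs?)
open import Data.List.Relation.Unary.Unique.Propositional using (Unique)
import Data.List.Relation.Unary.Unique.Propositional.Properties as Unique
import Data.List.Relation.Unary.Unique.DecPropositional as DecUnique
open import Data.List.Relation.Unary.Unique.DecPropositional.Properties using (deduplicate-!)
open import Relation.Nullary using (¬_; Dec; does; yes; no)
open import Relation.Nullary.Decidable using (_×-dec_; _⊎-dec_; ¬?; toWitness; decidable-stable)
open import Relation.Binary.Definitions using (DecidableEquality)
open import Relation.Binary.PropositionalEquality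
  using (_≡_; _≢_; refl; sym; trans; cong; subst; subst₂; module ≡-Reasoning)

data ℤ₃ : Set where
  z₀ z₁ z₂ : ℤ₃

suc₃ pred₃ : ℤ₃ → ℤ₃
suc₃ z₀ = z₁
suc₃ z₁ = z₂
suc₃ z₂ = z₀
pred₃ z₀ = z₂
pred₃ z₁ = z₀
pred₃ z₂ = z₁

_+₃_ : ℤ₃ → ℤ₃ → ℤ₃
a +₃ z₀ = a
a +₃ z₁ = suc₃ a
a +₃ z₂ = pred₃ a

suc₃-pred₃ : ∀ a → suc₃ (pred₃ a) ≡ a
suc₃-pred₃ z₀ = refl
suc₃-pred₃ z₁ = refl
suc₃-pred₃ z₂ = refl

pred₃-suc₃ : ∀ a → pred₃ (suc₃ a) ≡ a
pred₃-suc₃ z₀ = refl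
pred₃-suc₃ z₁ = refl
pred₃-suc₃ z₂ = refl

suc₃-+₃ : ∀ a b → suc₃ (a +₃ b) ≡ a +₃ suc₃ b
suc₃-+₃ a z₀ = refl
suc₃-+₃ z₀ z₁ = refl
suc₃-+₃ z₁ z₁ = refl
suc₃-+₃ z₂ z₁ = refl
suc₃-+₃ a z₂ = suc₃-pred₃ a

pred₃-+₃ : ∀ a b → pred₃ (a +₃ b) ≡ a +₃ pred₃ b
pred₃-+₃ a z₀ = refl
pred₃-+₃ a z₁ = pred₃-suc₃ a
pred₃-+₃ z₀ z₂ = refl
pred₃-+₃ z₁ z₂ = refl
pred₃-+₃ z₂ z₂ = refl

residueℕ residue⁻ : ℕ → ℤ₃
residueℕ zero = z₀
residueℕ (suc n) = suc₃ (residueℕ n)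
residue⁻ zero = z₀
residue⁻ (suc n) = pred₃ (residue⁻ n)

residue : ℤ → ℤ₃
residue (+ n) = residueℕ n
residue -[1+ n ] = residue⁻ (suc n)

residue-suc : ∀ z → residue (sucℤ z) ≡ suc₃ (residue z)
residue-suc (+ n) = refl
residue-suc -[1+ zero ] = refl
residue-suc -[1+ suc n ] = sym (suc₃-pred₃ (residue⁻ (suc n)))

residue-pred : ∀ z → residue (predℤ z) ≡ pred₃ (residue z)
residue-pred z = begin
  residue (predℤ z)                 ≡⟨ sym (pred₃-suc₃ _) ⟩
  pred₃ (suc₃ (residue (predℤ z)))  ≡⟨ cong pred₃ (sym (residue-suc (predℤ z))) ⟩
  pred₃ (residue (sucℤ (predℤ z)))  ≡⟨ cong (pred₃ ∘ residue) (ℤ.suc-pred z) ⟩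
  pred₃ (residue z)                 ∎
  where open ≡-Reasoning

residue-+ : ∀ u v → residue (u + v) ≡ residue u +₃ residue v
residue-+ u (+ zero) = cong residue (ℤ.+-identityʳ u)
residue-+ u (+ suc n) = begin
  residue (u + + suc n)             ≡⟨ cong residue (shuffle u (+ n)) ⟩
  residue (sucℤ (u + + n))          ≡⟨ residue-suc (u + + n) ⟩
  suc₃ (residue (u + + n))          ≡⟨ cong suc₃ (residue-+ u (+ n)) ⟩
  suc₃ (residue u +₃ residueℕ n)    ≡⟨ suc₃-+₃ (residue u) (residueℕ n) ⟩
  residue u +₃ residueℕ (suc n)     ∎
  where
  open ≡-Reasoning
  shuffle : ∀ (u w : ℤ) → u + (+ 1 + w) ≡ + 1 + (u + w)
  shuffle = solve-∀
residue-+ u -[1+ zero ] = trans (cong residue (ℤ.+-comm u -1ℤ)) (residue-pred u)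
residue-+ u -[1+ suc n ] = begin
  residue (u + -[1+ suc n ])           ≡⟨ cong residue (ℤ.+-pred u -[1+ n ]) ⟩
  residue (predℤ (u + -[1+ n ]))       ≡⟨ residue-pred (u + -[1+ n ]) ⟩
  pred₃ (residue (u + -[1+ n ]))       ≡⟨ cong pred₃ (residue-+ u -[1+ n ]) ⟩
  pred₃ (residue u +₃ residue -[1+ n ]) ≡⟨ pred₃-+₃ (residue u) (residue -[1+ n ]) ⟩
  residue u +₃ residue -[1+ suc n ]    ∎
  where open ≡-Reasoning

neighbour : Cell → ℤ₃ → Cell
neighbour (x , y , true)  z₀ = (x + + 1 , y , false)
neighbour (x , y , true)  z₁ = (x , y + + 1 , false)
neighbour (x , y , true)  z₂ = (x , y , false)
neighbour (x , y , false) z₀ = (x - + 1 , y , true)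
neighbour (x , y , false) z₁ = (x , y - + 1 , true)
neighbour (x , y , false) z₂ = (x , y , true)

neighbours : Cell → List Cell
neighbours c = neighbour c z₀ ∷ neighbour c z₁ ∷ neighbour c z₂ ∷ []

Adjacent : Cell → Cell → Set
Adjacent x y = y ∈ neighbours x

neighbour-adjacent : ∀ c d → Adjacent c (neighbour c d)
neighbour-adjacent c z₀ = here refl
neighbour-adjacent c z₁ = there (here refl)
neighbour-adjacent c z₂ = there (there (here refl))

adjacent-direction : ∀ {x y} → Adjacent x y → Σ ℤ₃ λ d → y ≡ neighbour x d
adjacent-direction (here e) = z₀ , e
adjacent-direction (there (here e)) = z₁ , e
adjacent-direction (there (there (here e))) = z₂ , e

isUp : Cell → Bool
isUp (_ , _ , u) = u

neighbour-flips : ∀ c d → isUp (neighbour c d) ≡ not (isUp c)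
neighbour-flips (x , y , true)  z₀ = refl
neighbour-flips (x , y , true)  z₁ = refl
neighbour-flips (x , y , true)  z₂ = refl
neighbour-flips (x , y , false) z₀ = refl
neighbour-flips (x , y , false) z₁ = refl
neighbour-flips (x , y , false) z₂ = refl

not-fixed : ∀ u → not u ≢ u
not-fixed true ()
not-fixed false ()

adjacent-irreflexive : ∀ c → ¬ Adjacent c c
adjacent-irreflexive c a with adjacent-direction a
... | d , e = not-fixed (isUp c) (trans (sym (neighbour-flips c d)) (cong isUp (sym e)))

shift-back : ∀ (x : ℤ) → x + + 1 - + 1 ≡ x
shift-back = solve-∀

shift-forth : ∀ (x : ℤ) → x - + 1 + + 1 ≡ x
shift-forth = solve-∀

swap+ : ∀ (x p k : ℤ) → x + p + k ≡ x + k + p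
swap+ = solve-∀

swap- : ∀ (x p k : ℤ) → x + p - k ≡ x - k + p
swap- = solve-∀

adjacent-sym : ∀ {x y} → Adjacent x y → Adjacent y x
adjacent-sym {x , y , true} (here refl) = here (cong (λ z → (z , y , true)) (sym (shift-back x)))
adjacent-sym {x , y , true} (there (here refl)) = there (here (cong (λ z → (x , z , true)) (sym (shift-back y))))
adjacent-sym {x , y , true} (there (there (here refl))) = there (there (here refl))
adjacent-sym {x , y , false} (here refl) = here (cong (λ z → (z , y , false)) (sym (shift-forth x)))
adjacent-sym {x , y , false} (there (here refl)) = there (here (cong (λ z → (x , z , false)) (sym (shift-forth y))))
adjacent-sym {x , y , false} (there (there (here refl))) = there (there (here refl))

shift : ℤ → ℤ → Cell → Cell
shift p q (x , y , u) = (x + p , y + q , u)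

neighbour-shift : ∀ p q c d → neighbour (shift p q c) d ≡ shift p q (neighbour c d)
neighbour-shift p q (x , y , true) z₀ = cong (λ z → (z , y + q , false)) (swap+ x p (+ 1))
neighbour-shift p q (x , y , true) z₁ = cong (λ z → (x + p , z , false)) (swap+ y q (+ 1))
neighbour-shift p q (x , y , true) z₂ = refl
neighbour-shift p q (x , y , false) z₀ = cong (λ z → (z , y + q , true)) (swap- x p (+ 1))
neighbour-shift p q (x , y , false) z₁ = cong (λ z → (x + p , z , true)) (swap- y q (+ 1))
neighbour-shift p q (x , y , false) z₂ = refl

-- Colour the positions by (x - y) mod 3; an upward cell of
-- colour k is paired with its neighbour in direction k, a downward cell with
-- the neighbour in the direction obtained by swapping z₀ and z₁.  This splits
-- the board into rhombi of two cells ("diamonds").  The pairing with offset r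
-- uses colour + r; translating by (p , q) turns offset 0 into offset p - q.

colour : ℤ → ℤ → ℤ₃
colour x y = residue (x - y)

colour-step : ∀ x y x′ y′ k → x′ - y′ ≡ (x - y) + k → colour x′ y′ ≡ colour x y +₃ residue k
colour-step x y x′ y′ k e = trans (cong residue e) (residue-+ (x - y) k)

partnerDirection : Bool → ℤ₃ → ℤ₃
partnerDirection true  k  = k
partnerDirection false z₀ = z₁
partnerDirection false z₁ = z₀
partnerDirection false z₂ = z₂

partnerDir : ℤ₃ → Cell → ℤ₃
partnerDir r (x , y , u) = partnerDirection u (colour x y +₃ r)

pairing : ℤ₃ → Cell → Cell
pairing r c = neighbour c (partnerDir r c)

partner : Cell → Cell
partner = pairing z₀

partner-adjacent : ∀ c → Adjacent c (partner c)
partner-adjacent c = neighbour-adjacent c (partnerDir z₀ c)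

partner-irreflexive : ∀ c → partner c ≢ c
partner-irreflexive c e = adjacent-irreflexive c (subst (Adjacent c) e (partner-adjacent c))

module _ (x y : ℤ) where
  colour-x+1 : colour (x + + 1) y ≡ suc₃ (colour x y)
  colour-x+1 = colour-step x y (x + + 1) y (+ 1) (shuffle x y)
    where shuffle : ∀ (x y : ℤ) → (x + + 1) - y ≡ (x - y) + + 1
          shuffle = solve-∀

  colour-y+1 : colour x (y + + 1) ≡ pred₃ (colour x y)
  colour-y+1 = colour-step x y x (y + + 1) -1ℤ (shuffle x y)
    where shuffle : ∀ (x y : ℤ) → x - (y + + 1) ≡ (x - y) + -1ℤ
          shuffle = solve-∀

  colour-x-1 : colour (x - + 1) y ≡ pred₃ (colour x y)
  colour-x-1 = colour-step x y (x - + 1) y -1ℤ (shuffle x y)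
    where shuffle : ∀ (x y : ℤ) → (x - + 1) - y ≡ (x - y) + -1ℤ
          shuffle = solve-∀

  colour-y-1 : colour x (y - + 1) ≡ suc₃ (colour x y)
  colour-y-1 = colour-step x y x (y - + 1) (+ 1) (shuffle x y)
    where shuffle : ∀ (x y : ℤ) → x - (y - + 1) ≡ (x - y) + + 1
          shuffle = solve-∀

  colour-shift : ∀ p q → colour (x + p) (y + q) ≡ colour x y +₃ residue (p - q)
  colour-shift p q = colour-step x y (x + p) (y + q) (p - q) (shuffle x y p q)
    where shuffle : ∀ (x y p q : ℤ) → (x + p) - (y + q) ≡ (x - y) + (p - q)
          shuffle = solve-∀

-- For instance an
-- upward cell (x , y) of colour z₀ has partner (x + 1 , y), which is
-- downward of colour z₁ and therefore points back in direction z₀.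
partner-involutive : ∀ c → partner (partner c) ≡ c
partner-involutive (x , y , true) with colour x y in eq
... | z₀ rewrite colour-x+1 x y | eq = cong (λ z → (z , y , true)) (shift-back x)
... | z₁ rewrite colour-y+1 x y | eq = cong (λ z → (x , z , true)) (shift-back y)
... | z₂ rewrite eq = refl
partner-involutive (x , y , false) with colour x y in eq
... | z₀ rewrite colour-y-1 x y | eq = cong (λ z → (x , z , false)) (shift-forth y)
... | z₁ rewrite colour-x-1 x y | eq = cong (λ z → (z , y , false)) (shift-forth x)
... | z₂ rewrite eq = refl

partner-shift : ∀ p q c → partner (shift p q c) ≡ shift p q (pairing (residue (p - q)) c)
partner-shift p q (x , y , u) rewrite colour-shift x y p q = neighbour-shift p q (x , y , u) _

ApartBy : (Cell → Cell) → Cell → Cell → Set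
ApartBy t x y = Adjacent x y × t x ≢ y

Apart : Cell → Cell → Set
Apart = ApartBy partner

apart-sym : ∀ {x y} → Apart x y → Apart y x
apart-sym {x} {y} (a , n) = adjacent-sym a , λ e → n (trans (cong partner (sym e)) (partner-involutive y))

apart-irreflexive : ∀ {x y} → Apart x y → x ≢ y
apart-irreflexive {x} (a , _) refl = adjacent-irreflexive x a

otherDirections : ℤ₃ → ℤ₃ × ℤ₃
otherDirections z₀ = z₁ , z₂
otherDirections z₁ = z₀ , z₂
otherDirections z₂ = z₀ , z₁

other-direction : ∀ d t → d ≢ t → d ≡ proj₁ (otherDirections t) ⊎ d ≡ proj₂ (otherDirections t)
other-direction z₀ z₀ n = ⊥-elim (n refl)
other-direction z₀ z₁ n = inj₁ refl
other-direction z₀ z₂ n = inj₁ refl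
other-direction z₁ z₀ n = inj₁ refl
other-direction z₁ z₁ n = ⊥-elim (n refl)
other-direction z₁ z₂ n = inj₂ refl
other-direction z₂ z₀ n = inj₂ refl
other-direction z₂ z₁ n = inj₂ refl
other-direction z₂ z₂ n = ⊥-elim (n refl)

apartNeighbours : Cell → Cell × Cell
apartNeighbours c = neighbour c (proj₁ others) , neighbour c (proj₂ others)
  where
  others : ℤ₃ × ℤ₃
  others = otherDirections (partnerDir z₀ c)

apart-cases : ∀ {x y} → Apart x y → y ≡ proj₁ (apartNeighbours x) ⊎ y ≡ proj₂ (apartNeighbours x)
apart-cases {x} {y} (a , n) with adjacent-direction a
... | d , e with other-direction d (partnerDir z₀ x) (λ d≡t → n (trans (cong (neighbour x) (sym d≡t)) (sym e)))
... | inj₁ d≡ = inj₁ (trans e (cong (neighbour x) d≡))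
... | inj₂ d≡ = inj₂ (trans e (cong (neighbour x) d≡))

_≟ᶜ_ : DecidableEquality Cell
_≟ᶜ_ = ≡-dec ℤ._≟_ (≡-dec ℤ._≟_ Bool._≟_)

_≟ᵗ_ : DecidableEquality Triple
_≟ᵗ_ = ≡-dec ℤ._≟_ (≡-dec ℤ._≟_ ℤ._≟_)

open DecMembership _≟ᶜ_ using (_∈?_)
open DecUnique _≟ᶜ_ using (unique?)

restore : ∀ (k x y : ℤ) → k - x - y + (x + y) ≡ k
restore = solve-∀

sums-differ : ∀ x y → + 1 - x - y ≢ + 2 - x - y
sums-differ x y e with trans (sym (restore (+ 1) x y)) (trans (cong (_+ (x + y)) e) (restore (+ 2) x y))
... | ()

-- Triple coordinates determine the cell: the orientation is recorded by the
-- coordinate sum (1 for upward, 2 for downward cells).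
toTriple-injective : ∀ {s t} → toTriple s ≡ toTriple t → s ≡ t
toTriple-injective {x , y , true}  {.x , .y , true}  refl = refl
toTriple-injective {x , y , false} {.x , .y , false} refl = refl
toTriple-injective {x , y , true}  {x′ , y′ , false} e with cong proj₁ e | cong (proj₁ ∘ proj₂) e
... | refl | refl = ⊥-elim (sums-differ x y (cong (proj₂ ∘ proj₂) e))
toTriple-injective {x , y , false} {x′ , y′ , true}  e with cong proj₁ e | cong (proj₁ ∘ proj₂) e
... | refl | refl = ⊥-elim (sums-differ x y (sym (cong (proj₂ ∘ proj₂) e)))

shift-injective : ∀ {p q s t} → shift p q s ≡ shift p q t → s ≡ t
shift-injective {p} {q} {x , y , u} {x′ , y′ , u′} e
  with +-cancelʳ p x x′ (cong proj₁ e) | +-cancelʳ q y y′ (cong (proj₁ ∘ proj₂) e) | cong (proj₂ ∘ proj₂) e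
... | refl | refl | refl = refl

toTriple-shift : ∀ p q c → toTriple (shift p q c) ≡ translate p q (toTriple c)
toTriple-shift p q (x , y , true) = cong (λ z → (x + p , y + q , z)) (shuffle (+ 1) x y p q)
  where shuffle : ∀ (k x y p q : ℤ) → k - (x + p) - (y + q) ≡ k - x - y - p - q
        shuffle = solve-∀
toTriple-shift p q (x , y , false) = cong (λ z → (x + p , y + q , z)) (shuffle (+ 2) x y p q)
  where shuffle : ∀ (k x y p q : ℤ) → k - (x + p) - (y + q) ≡ k - x - y - p - q
        shuffle = solve-∀

t₁ t₂ t₃ t₄ : Cell
t₁ = (+ 0 , + 0 , true)
t₂ = (+ 0 , + 1 , false)
t₃ = (+ 0 , + 1 , true)
t₄ = (+ 0 , + 2 , false)

linear : Perm3 → Bool → Triple → Triple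
linear σ ε t = invert ε (permute σ t)

-- The cell with given triple coordinates (valid when the coordinate sum is 1 or 2).
cellOf : Triple → Cell
cellOf (a , b , c) = (a , b , does ((a + b) + c ℤ.≟ + 1))

baseImage : Perm3 → Bool → Cell → Cell
baseImage σ ε c = cellOf (linear σ ε (toTriple c))

apartBy? : ∀ t x y → Dec (ApartBy t x y)
apartBy? t x y = (y ∈? neighbours x) ×-dec ¬? (t x ≟ᶜ y)

data Shape (t : Cell → Cell) (d₁ d₂ d₃ d₄ : Cell) : Set where
  partners₁₂ : t d₁ ≡ d₂ → ApartBy t d₂ d₃ → ApartBy t d₃ d₄ → Shape t d₁ d₂ d₃ d₄
  partners₂₃ : ApartBy t d₁ d₂ → t d₂ ≡ d₃ → ApartBy t d₃ d₄ → Shape t d₁ d₂ d₃ d₄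
  partners₃₄ : ApartBy t d₁ d₂ → ApartBy t d₂ d₃ → t d₃ ≡ d₄ → Shape t d₁ d₂ d₃ d₄

module BaseCopies where

  ShapeSum : (Cell → Cell) → Cell → Cell → Cell → Cell → Set
  ShapeSum t d₁ d₂ d₃ d₄ =
    (t d₁ ≡ d₂ × ApartBy t d₂ d₃ × ApartBy t d₃ d₄) ⊎
    (ApartBy t d₁ d₂ × t d₂ ≡ d₃ × ApartBy t d₃ d₄) ⊎
    (ApartBy t d₁ d₂ × ApartBy t d₂ d₃ × t d₃ ≡ d₄)

  toShape : ∀ {t d₁ d₂ d₃ d₄} → ShapeSum t d₁ d₂ d₃ d₄ → Shape t d₁ d₂ d₃ d₄
  toShape (inj₁ (p , a , a′)) = partners₁₂ p a a′
  toShape (inj₂ (inj₁ (a , p , a′))) = partners₂₃ a p a′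
  toShape (inj₂ (inj₂ (a , a′ , p))) = partners₃₄ a a′ p

  shapeSum? : ∀ t d₁ d₂ d₃ d₄ → Dec (ShapeSum t d₁ d₂ d₃ d₄)
  shapeSum? t d₁ d₂ d₃ d₄ =
    ((t d₁ ≟ᶜ d₂) ×-dec apartBy? t d₂ d₃ ×-dec apartBy? t d₃ d₄) ⊎-dec
    (apartBy? t d₁ d₂ ×-dec (t d₂ ≟ᶜ d₃) ×-dec apartBy? t d₃ d₄) ⊎-dec
    (apartBy? t d₁ d₂ ×-dec apartBy? t d₂ d₃ ×-dec (t d₃ ≟ᶜ d₄))

  Valid : Perm3 → Bool → Set
  Valid σ ε = All (λ c → toTriple (baseImage σ ε c) ≡ linear σ ε (toTriple c)) T41 ×
              Unique (map (baseImage σ ε) T41)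

  valid? : ∀ σ ε → Dec (Valid σ ε)
  valid? σ ε = all? (λ c → toTriple (baseImage σ ε c) ≟ᵗ linear σ ε (toTriple c)) T41 ×-dec
               unique? (map (baseImage σ ε) T41)

  BaseShape : Perm3 → Bool → ℤ₃ → Set
  BaseShape σ ε r = ShapeSum (pairing r) (f t₁) (f t₂) (f t₃) (f t₄)
    where f : Cell → Cell
          f = baseImage σ ε

  baseShape? : ∀ σ ε r → Dec (BaseShape σ ε r)
  baseShape? σ ε r = shapeSum? (pairing r) (f t₁) (f t₂) (f t₃) (f t₄)
    where f : Cell → Cell
          f = baseImage σ ε

  perms : List Perm3
  perms = abc ∷ acb ∷ bac ∷ bca ∷ cab ∷ cba ∷ []

  every-Perm3 : ∀ {P : Perm3 → Set} → All P perms → ∀ σ → P σ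
  every-Perm3 (p ∷ _) abc = p
  every-Perm3 (_ ∷ p ∷ _) acb = p
  every-Perm3 (_ ∷ _ ∷ p ∷ _) bac = p
  every-Perm3 (_ ∷ _ ∷ _ ∷ p ∷ _) bca = p
  every-Perm3 (_ ∷ _ ∷ _ ∷ _ ∷ p ∷ _) cab = p
  every-Perm3 (_ ∷ _ ∷ _ ∷ _ ∷ _ ∷ p ∷ _) cba = p

  bools : List Bool
  bools = false ∷ true ∷ []

  every-Bool : ∀ {P : Bool → Set} → All P bools → ∀ ε → P ε
  every-Bool (p ∷ _) false = p
  every-Bool (_ ∷ p ∷ _) true = p

  offsets : List ℤ₃
  offsets = z₀ ∷ z₁ ∷ z₂ ∷ []

  every-ℤ₃ : ∀ {P : ℤ₃ → Set} → All P offsets → ∀ r → P r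
  every-ℤ₃ (p ∷ _) z₀ = p
  every-ℤ₃ (_ ∷ p ∷ _) z₁ = p
  every-ℤ₃ (_ ∷ _ ∷ p ∷ _) z₂ = p

  valid : ∀ σ ε → Valid σ ε
  valid σ = every-Bool (every-Perm3 table σ)
    where
    table : All (λ σ → All (Valid σ) bools) perms
    table = toWitness {a? = all? (λ σ → all? (valid? σ) bools) perms} tt

  baseShape : ∀ σ ε r → Shape (pairing r) (baseImage σ ε t₁) (baseImage σ ε t₂) (baseImage σ ε t₃) (baseImage σ ε t₄)
  baseShape σ ε r = toShape (every-ℤ₃ (every-Bool (every-Perm3 table σ) ε) r)
    where
    table : All (λ σ → All (λ ε → All (BaseShape σ ε) offsets) bools) perms
    table = toWitness {a? = all? (λ σ → all? (λ ε → all? (baseShape? σ ε) offsets) bools) perms} tt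

adjacent-shift : ∀ p q {a b} → Adjacent a b → Adjacent (shift p q a) (shift p q b)
adjacent-shift p q {a} adj with adjacent-direction adj
... | d , refl = subst (Adjacent (shift p q a)) (neighbour-shift p q a d) (neighbour-adjacent (shift p q a) d)

module _ (p q : ℤ) where
  private
    r : ℤ₃
    r = residue (p - q)

  partners-shift : ∀ {a b} → pairing r a ≡ b → partner (shift p q a) ≡ shift p q b
  partners-shift {a} e = trans (partner-shift p q a) (cong (shift p q) e)

  apart-shift : ∀ {a b} → ApartBy (pairing r) a b → Apart (shift p q a) (shift p q b)
  apart-shift {a} (adj , n) =
    adjacent-shift p q adj , λ e → n (shift-injective (trans (sym (partner-shift p q a)) e))

  shape-shift : ∀ {d₁ d₂ d₃ d₄} → Shape (pairing r) d₁ d₂ d₃ d₄ →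
                Shape partner (shift p q d₁) (shift p q d₂) (shift p q d₃) (shift p q d₄)
  shape-shift (partners₁₂ e a a′) = partners₁₂ (partners-shift e) (apart-shift a) (apart-shift a′)
  shape-shift (partners₂₃ a e a′) = partners₂₃ (apart-shift a) (partners-shift e) (apart-shift a′)
  shape-shift (partners₃₄ a a′ e) = partners₃₄ (apart-shift a) (apart-shift a′) (partners-shift e)

-- Every copy of T41 in S yields a chain, and
-- the breaker strategies below only have to prevent chains.
record Chain (S : List Cell) : Set where
  constructor chain
  field
    d₁ d₂ d₃ d₄ : Cell
    members     : All (_∈ S) (d₁ ∷ d₂ ∷ d₃ ∷ d₄ ∷ [])
    distinct    : Unique (d₁ ∷ d₂ ∷ d₃ ∷ d₄ ∷ [])
    shape       : Shape partner d₁ d₂ d₃ d₄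

no-chain-in-[] : ¬ Chain []
no-chain-in-[] (chain _ _ _ _ (() ∷ _) _ _)

chainOfCopy : ∀ {S} → ContainsCopy T41 S → Chain S
chainOfCopy {S} (symmetry σ ε p q , a₁ ∷ a₂ ∷ a₃ ∷ a₄ ∷ []) with BaseCopies.valid σ ε
... | (v₁ ∷ v₂ ∷ v₃ ∷ v₄ ∷ []) , distinct =
  chain _ _ _ _ (located t₁ v₁ a₁ ∷ located t₂ v₂ a₂ ∷ located t₃ v₃ a₃ ∷ located t₄ v₄ a₄ ∷ [])
        (Unique.map⁺ shift-injective distinct)
        (shape-shift p q (BaseCopies.baseShape σ ε (residue (p - q))))
  where
  located : ∀ c → toTriple (baseImage σ ε c) ≡ linear σ ε (toTriple c) →
            Any (λ s → toTriple s ≡ translate p q (linear σ ε (toTriple c))) S →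
            shift p q (baseImage σ ε c) ∈ S
  located c v = Any.map λ e →
    toTriple-injective (trans (trans (toTriple-shift p q (baseImage σ ε c)) (cong (translate p q) v)) (sym e))

shape-path : ∀ {d₁ d₂ d₃ d₄} → Shape partner d₁ d₂ d₃ d₄ → Adjacent d₁ d₂ × Adjacent d₂ d₃ × Adjacent d₃ d₄
shape-path {d₁} {d₂} {d₃} (partners₁₂ refl (a , _) (a′ , _)) = partner-adjacent d₁ , a , a′
shape-path {d₁} {d₂} {d₃} (partners₂₃ (a , _) refl (a′ , _)) = a , partner-adjacent d₂ , a′
shape-path {d₁} {d₂} {d₃} (partners₃₄ (a , _) (a′ , _) refl) = a , a′ , partner-adjacent d₃

chain-partners : ∀ {S} → Chain S → Σ Cell λ x → x ∈ S × partner x ∈ S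
chain-partners (chain d₁ d₂ d₃ d₄ (m₁ ∷ m₂ ∷ m₃ ∷ m₄ ∷ []) _ (partners₁₂ refl _ _)) = d₁ , m₁ , m₂
chain-partners (chain d₁ d₂ d₃ d₄ (m₁ ∷ m₂ ∷ m₃ ∷ m₄ ∷ []) _ (partners₂₃ _ refl _)) = d₂ , m₂ , m₃
chain-partners (chain d₁ d₂ d₃ d₄ (m₁ ∷ m₂ ∷ m₃ ∷ m₄ ∷ []) _ (partners₃₄ _ _ refl)) = d₃ , m₃ , m₄

reverse-distinct : ∀ {d₁ d₂ d₃ d₄ : Cell} → Unique (d₁ ∷ d₂ ∷ d₃ ∷ d₄ ∷ []) → Unique (d₄ ∷ d₃ ∷ d₂ ∷ d₁ ∷ [])
reverse-distinct ((n₁₂ ∷ n₁₃ ∷ n₁₄ ∷ []) ∷ (n₂₃ ∷ n₂₄ ∷ []) ∷ (n₃₄ ∷ []) ∷ [] ∷ []) =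
  (flip n₃₄ ∷ flip n₂₄ ∷ flip n₁₄ ∷ []) ∷ (flip n₂₃ ∷ flip n₁₃ ∷ []) ∷ (flip n₁₂ ∷ []) ∷ [] ∷ []
  where
  flip : ∀ {x y : Cell} → x ≢ y → y ≢ x
  flip n e = n (sym e)

partners-sym : ∀ {x y} → partner x ≡ y → partner y ≡ x
partners-sym {x} refl = partner-involutive x

unique-⊆-length : ∀ {A : Set} {L X : List A} → Unique L → L ⊆ X → length L ≤ length X
unique-⊆-length {L = []} _ _ = z≤n
unique-⊆-length {L = z ∷ L} {X} (z∉L ∷ uL) L⊆X with ∈-∃++ (L⊆X (here refl))
... | X₁ , X₂ , refl = subst (suc (length L) ≤_) (sym (length-remove X₁))
      (s≤s (unique-⊆-length uL (λ m → remove X₁ (L⊆X (there m)) (λ e → All.lookup z∉L m (sym e)))))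
  where
  remove : ∀ {w} X₁ → w ∈ X₁ ++ z ∷ X₂ → w ≢ z → w ∈ X₁ ++ X₂
  remove X₁ m w≢z with ∈-++⁻ X₁ m
  ... | inj₁ m₁ = ∈-++⁺ˡ m₁
  ... | inj₂ (here e) = ⊥-elim (w≢z e)
  ... | inj₂ (there m₂) = ∈-++⁺ʳ X₁ m₂
  length-remove : ∀ X₁ → length (X₁ ++ z ∷ X₂) ≡ suc (length (X₁ ++ X₂))
  length-remove [] = refl
  length-remove (_ ∷ X₁) = cong suc (length-remove X₁)

too-many : ∀ {A : Set} {L X : List A} → Unique L → L ⊆ X → length X < length L → ⊥
too-many uL L⊆X lt = ℕ.<⇒≱ lt (unique-⊆-length uL L⊆X)

bound : List Cell → ℕ
bound [] = 0
bound ((x , _) ∷ L) = ∣ x ∣ +ℕ bound L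

bound-≥ : ∀ {c L} → c ∈ L → ∣ proj₁ c ∣ ≤ bound L
bound-≥ {L = (x , _) ∷ L} (here refl) = ℕ.m≤m+n ∣ x ∣ (bound L)
bound-≥ {L = (x , _) ∷ L} (there m) = ℕ.≤-trans (bound-≥ m) (ℕ.m≤n+m (bound L) ∣ x ∣)

fresh : List Cell → Cell
fresh L = (+ suc (bound L) , + 0 , true)

fresh-∉ : ∀ L → fresh L ∉ L
fresh-∉ L m = ℕ.<-irrefl refl (bound-≥ m)

pad : ℕ → List Cell → List Cell → List Cell
pad zero avoid acc = acc
pad (suc k) avoid acc = pad k avoid (fresh (avoid ++ acc) ∷ acc)

pad-length : ∀ k avoid acc → length (pad k avoid acc) ≡ k +ℕ length acc
pad-length zero avoid acc = refl
pad-length (suc k) avoid acc = trans (pad-length k avoid _) (ℕ.+-suc k (length acc))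

pad-unique : ∀ k avoid {acc} → Unique acc → Unique (pad k avoid acc)
pad-unique zero avoid u = u
pad-unique (suc k) avoid {acc} u = pad-unique k avoid
  (All.tabulate (λ m e → fresh-∉ (avoid ++ acc) (∈-++⁺ʳ avoid (subst (_∈ acc) (sym e) m))) ∷ u)

pad-avoids : ∀ k avoid {acc} → All (_∉ avoid) acc → All (_∉ avoid) (pad k avoid acc)
pad-avoids zero avoid f = f
pad-avoids (suc k) avoid {acc} f = pad-avoids k avoid ((λ m → fresh-∉ (avoid ++ acc) (∈-++⁺ˡ m)) ∷ f)

pad-⊇ : ∀ k avoid {acc} → acc ⊆ pad k avoid acc
pad-⊇ zero avoid m = m
pad-⊇ (suc k) avoid m = pad-⊇ k avoid (there m)

unmarked : List Cell → List Cell → List Cell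
unmarked marked wanted = deduplicate _≟ᶜ_ (filter (λ z → ¬? (z ∈? marked)) wanted)

unmarked-length : ∀ marked wanted → length (unmarked marked wanted) ≤ length wanted
unmarked-length marked wanted =
  ℕ.≤-trans (List.length-deduplicate _≟ᶜ_ (filter (λ z → ¬? (z ∈? marked)) wanted)) (List.length-filter (λ z → ¬? (z ∈? marked)) wanted)

unmarked-covers : ∀ marked {wanted z} → z ∈ wanted → z ∈ marked ⊎ z ∈ unmarked marked wanted
unmarked-covers marked {z = z} m with z ∈? marked
... | yes z∈ = inj₁ z∈
... | no z∉ = inj₂ (∈-deduplicate⁺ _≟ᶜ_ (∈-filter⁺ (λ z → ¬? (z ∈? marked)) m z∉))

claim : ℕ → List Cell → List Cell → List Cell
claim b marked wanted = pad (b ∸ length (unmarked marked wanted)) marked (unmarked marked wanted)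

claim-legal : ∀ b marked wanted → length wanted ≤ b → LegalMove b marked (claim b marked wanted)
claim-legal b marked wanted le =
  trans (pad-length k marked core) (ℕ.m∸n+n≡m (ℕ.≤-trans (unmarked-length marked wanted) le)) ,
  pad-unique k marked (deduplicate-! _≟ᶜ_ _) ,
  pad-avoids k marked (All.deduplicate⁺ _≟ᶜ_ (All.all-filter (λ z → ¬? (z ∈? marked)) wanted))
  where
  core : List Cell
  core = unmarked marked wanted
  k : ℕ
  k = b ∸ length core

claim-covers : ∀ b marked {wanted z} → z ∈ wanted → z ∈ marked ⊎ z ∈ claim b marked wanted
claim-covers b marked {wanted} m with unmarked-covers marked m
... | inj₁ z∈ = inj₁ z∈
... | inj₂ z∈ = inj₂ (pad-⊇ (b ∸ length (unmarked marked wanted)) marked z∈)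

still-marked : ∀ {A : Set} (xs M ys B : List A) → M ++ B ⊆ (xs ++ M) ++ (ys ++ B)
still-marked xs M ys B m with ∈-++⁻ M m
... | inj₁ m₁ = ∈-++⁺ˡ (∈-++⁺ʳ xs m₁)
... | inj₂ m₂ = ∈-++⁺ʳ (xs ++ M) (∈-++⁺ʳ ys m₂)

module BreakerStrategy
  (A : List Cell) (a b : ℕ)
  (response : List Cell → List Cell)
  (response-size : ∀ xs → length xs ≡ a → length (response xs) ≤ b)
  (Inv : List Cell → List Cell → Set)
  (inv-start : Inv [] [])
  (safe : ∀ {M B xs} → Inv M B → LegalMove a (M ++ B) xs → ¬ ContainsCopy A (xs ++ M))
  (preserved : ∀ {M B xs ys} → Inv M B → LegalMove a (M ++ B) xs →
               response xs ⊆ (xs ++ M) ++ (ys ++ B) → Inv (xs ++ M) (ys ++ B))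
  where

  breaker-survives : ∀ {M B} → Inv M B → ¬ MakerWins A a b M B
  breaker-survives I (move xs legal (inj₁ copy)) = safe I legal copy
  breaker-survives {M} {B} I (move xs legal (inj₂ next)) =
    breaker-survives (preserved I legal covered)
                     (next ys (claim-legal b marked (response xs) (response-size xs (proj₁ legal))))
    where
    marked ys : List Cell
    marked = (xs ++ M) ++ B
    ys = claim b marked (response xs)
    covered : response xs ⊆ (xs ++ M) ++ (ys ++ B)
    covered m with claim-covers b marked m
    ... | inj₂ m′ = ∈-++⁺ʳ (xs ++ M) (∈-++⁺ˡ m′)
    ... | inj₁ m′ with ∈-++⁻ (xs ++ M) m′
    ...   | inj₁ m″ = ∈-++⁺ˡ m″
    ...   | inj₂ m″ = ∈-++⁺ʳ (xs ++ M) (∈-++⁺ʳ ys m″)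

  loser : Loser A a b
  loser = breaker-survives inv-start

identity : Symmetry
identity = symmetry abc false (+ 0) (+ 0)

identity-fixes : ∀ t → applySym identity t ≡ t
identity-fixes (x , y , z) = cong₃ (ℤ.+-identityʳ x) (ℤ.+-identityʳ y) (zero-twice z)
  where
  zero-twice : ∀ (z : ℤ) → z - + 0 - + 0 ≡ z
  zero-twice z = trans (ℤ.+-identityʳ (z - + 0)) (ℤ.+-identityʳ z)
  cong₃ : ∀ {x x′ y y′ z z′ : ℤ} → x ≡ x′ → y ≡ y′ → z ≡ z′ → (x , y , z) ≡ (x′ , y′ , z′)
  cong₃ refl refl refl = refl

copy-of-subset : ∀ {A S} → A ⊆ S → ContainsCopy A S
copy-of-subset A⊆S = identity , All.tabulate λ {c} m →
  Any.map (λ {refl → sym (identity-fixes (toTriple c))}) (A⊆S m)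

immediate-win : ∀ {A} a b → Unique A → length A ≤ a → Winner A a b
immediate-win {A} a b uA le = move xs (legal , pad-unique k [] uA , pad-avoids k [] (All.tabulate λ _ ()))
                                   (inj₁ (copy-of-subset (λ m → ∈-++⁺ˡ (pad-⊇ k [] m))))
  where
  k : ℕ
  k = a ∸ length A
  xs : List Cell
  xs = pad k [] A
  legal : length xs ≡ a
  legal = trans (pad-length k [] A) (ℕ.m∸n+n≡m le)

single-move : ∀ {x M} → x ∉ M → LegalMove 1 (M ++ []) (x ∷ [])
single-move {x} {M} x∉M = refl , [] ∷ [] , subst (x ∉_) (sym (List.++-identityʳ M)) x∉M ∷ []

one-by-one : ∀ {A} x rest M → Unique (x ∷ rest) → All (_∉ M) (x ∷ rest) →
             A ⊆ (x ∷ rest) ++ M → MakerWins A 1 0 M []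
one-by-one x [] M _ (x∉M ∷ []) A⊆ = move (x ∷ []) (single-move x∉M) (inj₁ (copy-of-subset A⊆))
one-by-one {A} x (y ∷ rest) M (x∉rest ∷ u) (x∉M ∷ rest∉M) A⊆ = move (x ∷ []) (single-move x∉M) (inj₂ next)
  where
  next : ∀ ys → LegalMove 0 ((x ∷ M) ++ []) ys → MakerWins A 1 0 (x ∷ M) (ys ++ [])
  next [] _ = one-by-one y rest (x ∷ M) u (All.zipWith not-x∷M (x∉rest , rest∉M))
                         (λ m → ∈-resp-↭ (↭-sym (↭-shift x (y ∷ rest) M)) (A⊆ m))
    where
    not-x∷M : ∀ {z} → x ≢ z × z ∉ M → z ∉ x ∷ M
    not-x∷M (x≢z , _) (here z≡x) = x≢z (sym z≡x)
    not-x∷M (_ , z∉M) (there m) = z∉M m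
  next (_ ∷ _) (() , _)


opening : ∀ {xs} → Unique xs → LegalMove (length xs) [] xs
opening u = refl , u , All.tabulate (λ _ ())

-- If
-- there are more than b pairwise disjoint completions, breaker's b cells
-- cannot meet all of them.

DisjointFrom : List Cell → List Cell → Set
DisjointFrom E E′ = All (_∉ E′) E

Completion : List Cell → ℕ → List Cell → List Cell × Symmetry → Set
Completion A a M (E , g) =
  LegalMove a M E × All (λ c → Any (λ s → toTriple s ≡ applySym g (toTriple c)) (E ++ M)) A

-- A pairwise disjoint family of more than |ys| sets has a member avoiding ys:
-- otherwise choosing a cell of ys in each member yields that many distinct cells of ys.
module _ (ys : List Cell) where

  shared-cell : ∀ {E} → ¬ All (_∉ ys) E → Σ Cell λ w → w ∈ E × w ∈ ys
  shared-cell {E} h with find (All.¬All⇒Any¬ (λ z → ¬? (z ∈? ys)) E h)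
  ... | w , w∈E , ¬w∉ys = w , w∈E , decidable-stable (w ∈? ys) ¬w∉ys

  hitting-set : ∀ Es → AllPairs DisjointFrom Es → ¬ Any (All (_∉ ys)) Es →
    Σ (List Cell) λ ws → length ws ≡ length Es × Unique ws × ws ⊆ ys × All (λ w → Any (w ∈_) Es) ws
  hitting-set [] _ _ = [] , refl , [] , (λ ()) , []
  hitting-set (E ∷ Es) (E-disjoint ∷ disjoint) none
    with shared-cell (λ a → none (here a)) | hitting-set Es disjoint (λ a → none (there a))
  ... | w , w∈E , w∈ys | ws , len , unique , ws⊆ys , ws∈Es =
    w ∷ ws , cong suc len , All.map (λ a e → separate a (subst (_∈ E) e w∈E)) ws∈Es ∷ unique ,
    (λ { (here refl) → w∈ys ; (there m) → ws⊆ys m }) , here w∈E ∷ All.map there ws∈Es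
    where
    separate : ∀ {v} → Any (v ∈_) Es → v ∉ E
    separate a v∈E with find a
    ... | E′ , E′∈Es , v∈E′ = All.lookup (All.lookup E-disjoint E′∈Es) v∈E v∈E′

  avoiding-member : ∀ Es → AllPairs DisjointFrom Es → Unique ys → length ys < length Es →
                    Any (All (_∉ ys)) Es
  avoiding-member Es disjoint unique-ys lt with any? (λ E → all? (λ z → ¬? (z ∈? ys)) E) Es
  ... | yes a = a
  ... | no none with hitting-set Es disjoint none
  ... | ws , len , unique-ws , ws⊆ys , _ = ⊥-elim (too-many unique-ws ws⊆ys (subst (length ys <_) (sym len) lt))

two-move-win : ∀ {A a b} xs → LegalMove a [] xs → (Es : List (List Cell × Symmetry)) →
               AllPairs DisjointFrom (map proj₁ Es) → b < length Es →
               All (Completion A a (xs ++ [])) Es → Winner A a b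
two-move-win {A} {a} {b} xs legal Es disjoint more completions = move xs legal (inj₂ second)
  where
  second : ∀ ys → LegalMove b ((xs ++ []) ++ []) ys → MakerWins A a b (xs ++ []) (ys ++ [])
  second ys (len , unique-ys , _)
    with find (Any.map⁻ (avoiding-member ys (map proj₁ Es) disjoint unique-ys
                          (subst₂ _<_ (sym len) (sym (List.length-map proj₁ Es)) more)))
  ... | (E , g) , E∈Es , E∉ys with All.lookup completions E∈Es
  ... | (lenE , uniqueE , E∉xs) , copy = move E (lenE , uniqueE , All.tabulate free) (inj₁ (g , copy))
    where
    free : ∀ {z} → z ∈ E → z ∉ (xs ++ []) ++ (ys ++ [])
    free z∈E m with ∈-++⁻ (xs ++ []) m
    ... | inj₁ m₁ = All.lookup E∉xs z∈E m₁
    ... | inj₂ m₂ = All.lookup E∉ys z∈E (subst (_ ∈_) (List.++-identityʳ ys) m₂)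

module Round (M B xs : List Cell) (xs-unmarked : All (_∉ M ++ B) xs) where

  new-unmarked : ∀ {x} → x ∈ xs → x ∉ M ++ B
  new-unmarked = All.lookup xs-unmarked

  new-not-old : ∀ {x} → x ∈ xs → x ∉ M
  new-not-old x∈xs x∈M = new-unmarked x∈xs (∈-++⁺ˡ x∈M)

  old-if-marked : ∀ {x} → x ∈ xs ++ M → x ∈ M ++ B → x ∈ M
  old-if-marked x∈ marked with ∈-++⁻ xs x∈
  ... | inj₁ x∈xs = ⊥-elim (All.lookup xs-unmarked x∈xs marked)
  ... | inj₂ x∈M = x∈M

  SameSide : Cell → Cell → Set
  SameSide x y = (x ∈ xs × y ∈ xs) ⊎ (x ∈ M × y ∈ M)

  same-side : (R : Cell → Cell → Set) → (∀ {x y} → R x y → R y x) →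
              (∀ {x} → x ∈ M → ∀ {y} → R x y → y ∈ M ++ B) →
              ∀ {x y} → x ∈ xs ++ M → y ∈ xs ++ M → R x y → SameSide x y
  same-side R R-sym closed {x} {y} x∈ y∈ r with ∈-++⁻ xs x∈ | ∈-++⁻ xs y∈
  ... | inj₁ x∈xs | inj₁ y∈xs = inj₁ (x∈xs , y∈xs)
  ... | inj₂ x∈M | inj₂ y∈M = inj₂ (x∈M , y∈M)
  ... | inj₁ x∈xs | inj₂ y∈M = ⊥-elim (All.lookup xs-unmarked x∈xs (closed y∈M (R-sym r)))
  ... | inj₂ x∈M | inj₁ y∈xs = ⊥-elim (All.lookup xs-unmarked y∈xs (closed x∈M r))

  one-side : ∀ {d₁ d₂ d₃ d₄} → SameSide d₁ d₂ → SameSide d₂ d₃ → SameSide d₃ d₄ →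
             All (_∈ xs) (d₁ ∷ d₂ ∷ d₃ ∷ d₄ ∷ []) ⊎ All (_∈ M) (d₁ ∷ d₂ ∷ d₃ ∷ d₄ ∷ [])
  one-side (inj₁ (n₁ , n₂)) (inj₁ (_ , n₃)) (inj₁ (_ , n₄)) = inj₁ (n₁ ∷ n₂ ∷ n₃ ∷ n₄ ∷ [])
  one-side (inj₂ (o₁ , o₂)) (inj₂ (_ , o₃)) (inj₂ (_ , o₄)) = inj₂ (o₁ ∷ o₂ ∷ o₃ ∷ o₄ ∷ [])
  one-side (inj₁ (_ , n₂)) (inj₂ (o₂ , _)) _ = ⊥-elim (new-not-old n₂ o₂)
  one-side (inj₂ (_ , o₂)) (inj₁ (n₂ , _)) _ = ⊥-elim (new-not-old n₂ o₂)
  one-side _ (inj₁ (_ , n₃)) (inj₂ (o₃ , _)) = ⊥-elim (new-not-old n₃ o₃)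
  one-side _ (inj₂ (_ , o₃)) (inj₁ (n₃ , _)) = ⊥-elim (new-not-old n₃ o₃)

-- (1,1): the pairing strategy.  Breaker claims the partner of maker's cell;
-- then maker never owns a pair of partners, which every chain contains.
module PairingStrategy where

  Inv : List Cell → List Cell → Set
  Inv M B = (∀ {x} → x ∈ M → partner x ∈ M ++ B) × (∀ {x} → x ∈ M → partner x ∉ M)

  response : List Cell → List Cell
  response (z ∷ []) = partner z ∷ []
  response _ = []

  response-size : ∀ xs → length xs ≡ 1 → length (response xs) ≤ 1
  response-size (z ∷ []) _ = s≤s z≤n

  no-pair : ∀ {M B z} → Inv M B → z ∉ M ++ B → ∀ {x} → x ∈ z ∷ M → partner x ∉ z ∷ M
  no-pair {z = z} I z∉ (here refl) (here e) = partner-irreflexive z e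
  no-pair {z = z} I z∉ (here refl) (there m) = z∉ (subst (_∈ _) (partner-involutive z) (proj₁ I m))
  no-pair I z∉ (there m) (here e) = z∉ (subst (_∈ _) e (proj₁ I m))
  no-pair I z∉ (there m) (there m′) = proj₂ I m m′

  safe : ∀ {M B xs} → Inv M B → LegalMove 1 (M ++ B) xs → ¬ ContainsCopy T41 (xs ++ M)
  safe I (_ , _ , z∉ ∷ []) copy with chain-partners (chainOfCopy copy)
  ... | x , x∈ , px∈ = no-pair I z∉ x∈ px∈

  preserved : ∀ {M B xs ys} → Inv M B → LegalMove 1 (M ++ B) xs →
              response xs ⊆ (xs ++ M) ++ (ys ++ B) → Inv (xs ++ M) (ys ++ B)
  preserved {M} {B} {z ∷ []} {ys} I (_ , _ , z∉ ∷ []) covered = partner-marked , no-pair I z∉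
    where
    partner-marked : ∀ {x} → x ∈ z ∷ M → partner x ∈ (z ∷ M) ++ (ys ++ B)
    partner-marked (here refl) = covered (here refl)
    partner-marked (there m) = still-marked (z ∷ []) M ys B (proj₁ I m)

  open BreakerStrategy T41 1 1 response response-size Inv ((λ ()) , (λ ())) safe preserved public
    using (loser)

-- (3,9): breaker claims all neighbours of maker's three new cells.  Then
-- maker's cells never touch across rounds, so a chain would have to be
-- claimed in a single move (impossible with three cells) or be old.
module NeighbourhoodStrategy where

  Inv : List Cell → List Cell → Set
  Inv M B = (∀ {x} → x ∈ M → ∀ {y} → Adjacent x y → y ∈ M ++ B) × ¬ Chain M

  response : List Cell → List Cell
  response = concatMap neighbours

  response-size : ∀ xs → length xs ≡ 3 → length (response xs) ≤ 9
  response-size (_ ∷ _ ∷ _ ∷ []) _ = ℕ.≤-refl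

  no-chain : ∀ {M B xs} → Inv M B → LegalMove 3 (M ++ B) xs → ¬ Chain (xs ++ M)
  no-chain {M} {B} {xs} (closed , no-old) (len , _ , fresh) (chain d₁ d₂ d₃ d₄ (m₁ ∷ m₂ ∷ m₃ ∷ m₄ ∷ []) ds s) =
    [ (λ new → too-many ds (All.lookup new) (subst (_< 4) (sym len) ℕ.≤-refl))
    , (λ old → no-old (chain d₁ d₂ d₃ d₄ old ds s)) ] sides
    where
    open Round M B xs fresh
    sides : All (_∈ xs) (d₁ ∷ d₂ ∷ d₃ ∷ d₄ ∷ []) ⊎ All (_∈ M) (d₁ ∷ d₂ ∷ d₃ ∷ d₄ ∷ [])
    sides with shape-path s
    ... | a₁₂ , a₂₃ , a₃₄ = one-side (side m₁ m₂ a₁₂) (side m₂ m₃ a₂₃) (side m₃ m₄ a₃₄)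
      where
      side : ∀ {x y} → x ∈ xs ++ M → y ∈ xs ++ M → Adjacent x y → SameSide x y
      side = same-side Adjacent adjacent-sym closed

  preserved : ∀ {M B xs ys} → Inv M B → LegalMove 3 (M ++ B) xs →
              response xs ⊆ (xs ++ M) ++ (ys ++ B) → Inv (xs ++ M) (ys ++ B)
  preserved {M} {B} {xs} {ys} I legal covered = closed′ , no-chain I legal
    where
    closed′ : ∀ {x} → x ∈ xs ++ M → ∀ {y} → Adjacent x y → y ∈ (xs ++ M) ++ (ys ++ B)
    closed′ x∈ a with ∈-++⁻ xs x∈
    ... | inj₁ x∈xs = covered (Any.concatMap⁺ neighbours (Any.map (λ {refl → a}) x∈xs))
    ... | inj₂ x∈M = still-marked xs M ys B (proj₁ I x∈M a)

  open BreakerStrategy T41 3 9 response response-size Inv ((λ ()) , no-chain-in-[])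
                       (λ I legal → no-chain I legal ∘ chainOfCopy) preserved public
    using (loser)

-- (2,4): breaker keeps every apart neighbour of maker's cells marked, and
-- the partner of every maker cell that has an apart neighbour among maker's
-- cells.  A chain then cannot straddle two rounds, and two cells are too few.
module DiamondStrategy where

  Inv : List Cell → List Cell → Set
  Inv M B = (∀ {x} → x ∈ M → ∀ {y} → Apart x y → y ∈ M ++ B) ×
            (∀ {x y} → x ∈ M → y ∈ M → Apart x y → partner x ∈ M ++ B) ×
            ¬ Chain M

  apart? : ∀ x y → Dec (Apart x y)
  apart? = apartBy? partner

  otherApart : Cell → Cell → Cell
  otherApart u v with proj₁ (apartNeighbours u) ≟ᶜ v
  ... | yes _ = proj₂ (apartNeighbours u)
  ... | no _ = proj₁ (apartNeighbours u)

  other-apart : ∀ {u v y} → Apart u v → Apart u y → y ≡ v ⊎ y ≡ otherApart u v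
  other-apart {u} {v} uv uy with proj₁ (apartNeighbours u) ≟ᶜ v | apart-cases uy | apart-cases uv
  ... | yes first≡v | inj₁ y≡first | _ = inj₁ (trans y≡first first≡v)
  ... | yes _ | inj₂ y≡second | _ = inj₂ y≡second
  ... | no _ | inj₁ y≡first | _ = inj₂ y≡first
  ... | no first≢v | inj₂ _ | inj₁ v≡first = ⊥-elim (first≢v (sym v≡first))
  ... | no _ | inj₂ y≡second | inj₂ v≡second = inj₁ (trans y≡second (sym v≡second))

  response : List Cell → List Cell
  response (u ∷ v ∷ []) with apart? u v
  ... | yes _ = partner u ∷ partner v ∷ otherApart u v ∷ otherApart v u ∷ []
  ... | no _ = proj₁ (apartNeighbours u) ∷ proj₂ (apartNeighbours u) ∷
               proj₁ (apartNeighbours v) ∷ proj₂ (apartNeighbours v) ∷ []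
  response _ = []

  response-size : ∀ xs → length xs ≡ 2 → length (response xs) ≤ 4
  response-size (u ∷ v ∷ []) _ with apart? u v
  ... | yes _ = ℕ.≤-refl
  ... | no _ = ℕ.≤-refl

  apart-covered : ∀ {u v x y} → x ∈ u ∷ v ∷ [] → Apart x y → y ∈ u ∷ v ∷ [] ⊎ y ∈ response (u ∷ v ∷ [])
  apart-covered {u} {v} x∈ a with apart? u v
  apart-covered (here refl) a | yes uv with other-apart uv a
  ... | inj₁ y≡v = inj₁ (there (here y≡v))
  ... | inj₂ y≡other = inj₂ (there (there (here y≡other)))
  apart-covered (there (here refl)) a | yes uv with other-apart (apart-sym uv) a
  ... | inj₁ y≡u = inj₁ (here y≡u)
  ... | inj₂ y≡other = inj₂ (there (there (there (here y≡other))))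
  apart-covered (here refl) a | no _ with apart-cases a
  ... | inj₁ e = inj₂ (here e)
  ... | inj₂ e = inj₂ (there (here e))
  apart-covered (there (here refl)) a | no _ with apart-cases a
  ... | inj₁ e = inj₂ (there (there (here e)))
  ... | inj₂ e = inj₂ (there (there (there (here e))))

  partner-covered : ∀ {u v x y} → x ∈ u ∷ v ∷ [] → y ∈ u ∷ v ∷ [] → Apart x y →
                    partner x ∈ response (u ∷ v ∷ [])
  partner-covered {u} {v} x∈ y∈ a with apart? u v
  partner-covered (here refl) _ a | yes _ = here refl
  partner-covered (there (here refl)) _ a | yes _ = there (here refl)
  partner-covered (here refl) (here refl) a | no _ = ⊥-elim (apart-irreflexive a refl)
  partner-covered (here refl) (there (here refl)) a | no ¬uv = ⊥-elim (¬uv a)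
  partner-covered (there (here refl)) (here refl) a | no ¬uv = ⊥-elim (¬uv (apart-sym a))
  partner-covered (there (here refl)) (there (here refl)) a | no _ = ⊥-elim (apart-irreflexive a refl)

  no-chain : ∀ {M B xs} → Inv M B → LegalMove 2 (M ++ B) xs → ¬ Chain (xs ++ M)
  no-chain {M} {B} {xs} (closed , guarded , no-old) (len , _ , fresh) (chain _ _ _ _ ms ds s) = by-shape ms ds s
    where
    open Round M B xs fresh
    side : ∀ {x y} → x ∈ xs ++ M → y ∈ xs ++ M → Apart x y → SameSide x y
    side = same-side Apart apart-sym closed

    three-new : ∀ {a b c} → Unique (a ∷ b ∷ c ∷ []) → a ∈ xs → b ∈ xs → c ∈ xs → ⊥
    three-new u na nb nc = too-many u (All.lookup (na ∷ nb ∷ nc ∷ [])) (subst (_< 3) (sym len) ℕ.≤-refl)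

    -- The partner edge is the first edge: d₂ d₃ d₄ lie on one side; if old,
    -- the partner d₁ of d₂ is guarded, hence old as well.
    first : ∀ {d₁ d₂ d₃ d₄} → All (_∈ xs ++ M) (d₁ ∷ d₂ ∷ d₃ ∷ d₄ ∷ []) → Unique (d₁ ∷ d₂ ∷ d₃ ∷ d₄ ∷ []) →
            partner d₁ ≡ d₂ → Apart d₂ d₃ → Apart d₃ d₄ → ⊥
    first {d₁} (m₁ ∷ m₂ ∷ m₃ ∷ m₄ ∷ []) ds p a₂₃ a₃₄ with side m₂ m₃ a₂₃ | side m₃ m₄ a₃₄
    ... | inj₁ (n₂ , n₃) | inj₁ (_ , n₄) = three-new (Unique.drop⁺ 1 ds) n₂ n₃ n₄
    ... | inj₁ (_ , n₃) | inj₂ (o₃ , _) = new-not-old n₃ o₃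
    ... | inj₂ (_ , o₃) | inj₁ (n₃ , _) = new-not-old n₃ o₃
    ... | inj₂ (o₂ , o₃) | inj₂ (_ , o₄) = no-old (chain _ _ _ _ (o₁ ∷ o₂ ∷ o₃ ∷ o₄ ∷ []) ds (partners₁₂ p a₂₃ a₃₄))
      where
      o₁ : d₁ ∈ M
      o₁ = old-if-marked m₁ (subst (_∈ M ++ B) (partners-sym p) (guarded o₂ o₃ a₂₃))

    -- The partner edge is the middle edge: each outer edge lies on one side,
    -- and a guarded partner rules out mixing the two.
    middle : ∀ {d₁ d₂ d₃ d₄} → All (_∈ xs ++ M) (d₁ ∷ d₂ ∷ d₃ ∷ d₄ ∷ []) → Unique (d₁ ∷ d₂ ∷ d₃ ∷ d₄ ∷ []) →
             Apart d₁ d₂ → partner d₂ ≡ d₃ → Apart d₃ d₄ → ⊥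
    middle (m₁ ∷ m₂ ∷ m₃ ∷ m₄ ∷ []) ds a₁₂ p a₃₄ with side m₁ m₂ a₁₂ | side m₃ m₄ a₃₄
    ... | inj₁ (n₁ , n₂) | inj₁ (n₃ , _) = three-new (Unique.take⁺ 3 ds) n₁ n₂ n₃
    ... | inj₁ (_ , n₂) | inj₂ (o₃ , o₄) = new-unmarked n₂ (subst (_∈ M ++ B) (partners-sym p) (guarded o₃ o₄ a₃₄))
    ... | inj₂ (o₁ , o₂) | inj₁ (n₃ , _) = new-unmarked n₃ (subst (_∈ M ++ B) p (guarded o₂ o₁ (apart-sym a₁₂)))
    ... | inj₂ (o₁ , o₂) | inj₂ (o₃ , o₄) = no-old (chain _ _ _ _ (o₁ ∷ o₂ ∷ o₃ ∷ o₄ ∷ []) ds (partners₂₃ a₁₂ p a₃₄))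

    by-shape : ∀ {d₁ d₂ d₃ d₄} → All (_∈ xs ++ M) (d₁ ∷ d₂ ∷ d₃ ∷ d₄ ∷ []) → Unique (d₁ ∷ d₂ ∷ d₃ ∷ d₄ ∷ []) →
               Shape partner d₁ d₂ d₃ d₄ → ⊥
    by-shape ms ds (partners₁₂ p a a′) = first ms ds p a a′
    by-shape ms ds (partners₂₃ a p a′) = middle ms ds a p a′
    by-shape (m₁ ∷ m₂ ∷ m₃ ∷ m₄ ∷ []) ds (partners₃₄ a a′ p) =
      first (m₄ ∷ m₃ ∷ m₂ ∷ m₁ ∷ []) (reverse-distinct ds) (partners-sym p) (apart-sym a′) (apart-sym a)

  preserved : ∀ {M B xs ys} → Inv M B → LegalMove 2 (M ++ B) xs →
              response xs ⊆ (xs ++ M) ++ (ys ++ B) → Inv (xs ++ M) (ys ++ B)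
  preserved {M} {B} {u ∷ v ∷ []} {ys} I@(closed , guarded , _) (len , uq , fresh) covered =
    closed′ , guarded′ , no-chain I (len , uq , fresh)
    where
    xs : List Cell
    xs = u ∷ v ∷ []
    open Round M B xs fresh

    closed′ : ∀ {x} → x ∈ xs ++ M → ∀ {y} → Apart x y → y ∈ (xs ++ M) ++ (ys ++ B)
    closed′ x∈ a with ∈-++⁻ xs x∈
    ... | inj₂ x∈M = still-marked xs M ys B (closed x∈M a)
    ... | inj₁ x∈xs with apart-covered x∈xs a
    ...   | inj₁ y∈xs = ∈-++⁺ˡ {ys = ys ++ B} (∈-++⁺ˡ {ys = M} y∈xs)
    ...   | inj₂ y∈response = covered y∈response

    guarded′ : ∀ {x y} → x ∈ xs ++ M → y ∈ xs ++ M → Apart x y → partner x ∈ (xs ++ M) ++ (ys ++ B)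
    guarded′ x∈ y∈ a with same-side Apart apart-sym closed x∈ y∈ a
    ... | inj₁ (x∈xs , y∈xs) = covered (partner-covered x∈xs y∈xs a)
    ... | inj₂ (x∈M , y∈M) = still-marked xs M ys B (guarded x∈M y∈M a)

  open BreakerStrategy T41 2 4 response response-size Inv ((λ ()) , (λ ()) , no-chain-in-[])
                       (λ I legal → no-chain I legal ∘ chainOfCopy) preserved public
    using (loser)

T41-unique : Unique T41
T41-unique = toWitness {a? = unique? T41} tt

completion? : ∀ A a M e → Dec (Completion A a M e)
completion? A a M (E , g) =
  ((length E ℕ.≟ a) ×-dec unique? E ×-dec all? (λ z → ¬? (z ∈? M)) E) ×-dec
  all? (λ c → any? (λ s → toTriple s ≟ᵗ applySym g (toTriple c)) (E ++ M)) A

disjoint? : ∀ Es → Dec (AllPairs DisjointFrom Es)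
disjoint? = allPairs? (λ E E′ → all? (λ z → ¬? (z ∈? E′)) E)

-- (2,3): maker claims two adjacent cells; they extend to a straight
-- tetriamond in four ways, using four pairwise disjoint pairs of cells.
diamond : List Cell
diamond = (+ 0 , + 0 , true) ∷ (+ 0 , + 1 , false) ∷ []

diamond-completions : List (List Cell × Symmetry)
diamond-completions =
  ((+ 0 , -[1+ 0 ] , true) ∷ (+ 0 , + 0 , false) ∷ [] , symmetry abc false (+ 0) -[1+ 0 ]) ∷
  ((+ 0 , + 1 , true) ∷ (+ 0 , + 2 , false) ∷ [] , symmetry abc false (+ 0) (+ 0)) ∷
  ((-[1+ 0 ] , + 2 , false) ∷ (-[1+ 0 ] , + 1 , true) ∷ [] , symmetry cba false -[1+ 0 ] (+ 0)) ∷
  ((+ 1 , + 0 , false) ∷ (+ 1 , -[1+ 0 ] , true) ∷ [] , symmetry cba false (+ 0) -[1+ 0 ]) ∷ []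

win-2-3 : Winner T41 2 3
win-2-3 = two-move-win diamond (opening (toWitness {a? = unique? diamond} tt)) diamond-completions
  (toWitness {a? = disjoint? (map proj₁ diamond-completions)} tt)
  (s≤s (s≤s (s≤s (s≤s z≤n))))
  (toWitness {a? = all? (completion? T41 2 (diamond ++ [])) diamond-completions} tt)

-- (3,8): maker claims three upward cells far apart.  An upward cell is the
-- end cell of three straight tetriamonds pointing in different directions,
-- whose other cells are pairwise disjoint (`spokes`); this gives nine
-- pairwise disjoint completions.
spokes : ℤ → List (List Cell × Symmetry)
spokes p =
  ((p , -[1+ 0 ] , false) ∷ (p , -[1+ 0 ] , true) ∷ (p , + 0 , false) ∷ [] , symmetry acb false p -[1+ 0 ]) ∷
  ((p , + 1 , false) ∷ (p , + 1 , true) ∷ (p , + 2 , false) ∷ [] , symmetry abc false p (+ 0)) ∷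
  ((p + + 1 , + 0 , false) ∷ (p + + 1 , + 0 , true) ∷ (p + + 2 , + 0 , false) ∷ [] , symmetry bac false p (+ 0)) ∷ []

triple : List Cell
triple = (+ 0 , + 0 , true) ∷ (+ 10 , + 0 , true) ∷ (+ 20 , + 0 , true) ∷ []

triple-completions : List (List Cell × Symmetry)
triple-completions = spokes (+ 0) ++ spokes (+ 10) ++ spokes (+ 20)

win-3-8 : Winner T41 3 8
win-3-8 = two-move-win triple (opening (toWitness {a? = unique? triple} tt)) triple-completions
  (toWitness {a? = disjoint? (map proj₁ triple-completions)} tt)
  (s≤s (s≤s (s≤s (s≤s (s≤s (s≤s (s≤s (s≤s (s≤s z≤n)))))))))
  (toWitness {a? = all? (completion? T41 3 (triple ++ [])) triple-completions} tt)

win-1-0 : Winner T41 1 0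
win-1-0 = one-by-one _ _ [] T41-unique (All.tabulate (λ _ ())) ∈-++⁺ˡ

proposition6p3 :
    Winner T41 1 0 × Loser T41 1 1 ×
    Winner T41 2 3 × Loser T41 2 4 ×
    Winner T41 3 8 × Loser T41 3 9 ×
    ((n b : ℕ) → n ≥ 4 → Winner T41 n b)
proposition6p3 =
  win-1-0 , PairingStrategy.loser ,
  win-2-3 , DiamondStrategy.loser ,
  win-3-8 , NeighbourhoodStrategy.loser ,
  λ n b n≥4 → immediate-win n b T41-unique n≥4
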